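{- There is a constant $c$ such that for every $n\ge 1$ the following holds. For any input sequence $s\in\{0,1\}^{\ell}$ with $0\le \ell\le n$ having $k$ runs, there exists an adaptive algorithm that exactly recovers $s$ using at most $2k\log(n/k)+\log n+k+c$ queries, each query being a sequence over $\{0,1\}$ of length at most $n$ (no extra characters), where each query $q$ returns the exact Levenshtein distance $d_L(s,q)$.
   Context: The Levenshtein (edit) distance $d_L(x,y)$ is the minimal number of single-symbol insertions, deletions and substitutions transforming $x$ into $y$. A run of a sequence is a maximal substring consisting of a single repeated character. Query model: $s$ is unknown (its length is also unknown); the algorithm chooses query sequences $q$, possibly depending on previous answers (adaptive), and receives $d_L(s,q)$. -}

module Defs where

open import Data.Nat using (ℕ; zero; suc; _+_; _*_; _^_; _≤_)
open import Data.Bool using (Bool; true; false; if_then_else_)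
open import Data.List using (List; []; _∷_; _++_; length)
open import Data.Product using (Σ; _×_; ∃-syntax)

Seq : Set
Seq = List Bool

data Edit : Seq → Seq → Set where
  ins : (u v : Seq) (b : Bool)   → Edit (u ++ v) (u ++ b ∷ v)
  del : (u v : Seq) (b : Bool)   → Edit (u ++ b ∷ v) (u ++ v)
  sub : (u v : Seq) (a b : Bool) → Edit (u ++ a ∷ v) (u ++ b ∷ v)

data Edits : ℕ → Seq → Seq → Set where
  none : ∀ {x} → Edits zero x x
  step : ∀ {m x y z} → Edit x y → Edits m y z → Edits (suc m) x z

IsLevDist : Seq → Seq → ℕ → Set
IsLevDist x y d = Edits d x y × (∀ m → Edits m x y → d ≤ m)

eqB : Bool → Bool → Bool
eqB true  true  = true
eqB false false = true
eqB _     _     = false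

runs : Seq → ℕ
runs []             = 0
runs (x ∷ [])       = 1
runs (x ∷ y ∷ zs)   = (if eqB x y then 0 else 1) + runs (y ∷ zs)

-- Adaptive query algorithms as decision trees: either output a sequence,
-- or ask a query sequence q and continue depending on the answer d_L(s,q).
data Alg : Set where
  output : Seq → Alg
  query  : Seq → (ℕ → Alg) → Alg

data Runs (n : ℕ) (s : Seq) : Alg → Seq → ℕ → Set where
  done : ∀ {o} → Runs n s (output o) o zero
  ask  : ∀ {q f d o m} → length q ≤ n → IsLevDist s q d →
         Runs n s (f d) o m → Runs n s (query q f) o (suc m)

-- The query bound  m ≤ 2k log₂(n/k) + log₂ n + k + c , written without logs
-- (equivalently, by monotonicity of 2^x):  2^m · k^(2k) ≤ n^(2k+1) · 2^(k+c).
-- For k = 0 this reads 2^m ≤ n · 2^c, i.e. the convention k log(n/k) = 0.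
QueryBound : ℕ → ℕ → ℕ → ℕ → Set
QueryBound c n k m = 2 ^ m * k ^ (2 * k) ≤ n ^ (2 * k + 1) * 2 ^ (k + c)

{-# OPTIONS --safe #-}
-- Since each query costs at least |s| − |q| edits, with equality exactly for subsequences, the
-- answer to q reveals whether q is a subsequence of s. The empty query yields |s|, and bisection
-- over subsequence tests 1^j yields the number of ones (about log n queries). The runs are then
-- read off one at a time: if the prefix p is known and the next run has symbol c, then
-- p c^j c̄^e, with e the number of c̄ still to come, is a subsequence of s iff j is at most the run
-- length r, so galloping search finds r with 2 log r + 1 queries. Altogether 2^m ≤ 8n ∏ 2r_i², and
-- AM–GM, k^k ∏ r_i ≤ (∑ r_i)^k ≤ n^k, turns this into the claimed bound.
module Submission where

open import Defs
open import Data.Nat using (ℕ; zero; suc; _+_; _*_; _∸_; _^_; _≤_; _<_; _≥_; z≤n; s≤s; _≟_; _≤?_; _<?_; NonZero)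
open import Data.Nat.Properties
open import Data.Nat.Induction using (<-rec)
open import Data.Nat.Tactic.RingSolver using (solve-∀)
open import Data.Bool using (Bool; true; false; not; if_then_else_)
import Data.Bool.Properties as Bool
open import Data.List using (List; []; _∷_; _++_; length; replicate; map)
open import Data.Nat.ListAction using (sum; product)
open import Data.List.Properties using (length-++; length-replicate; ++-assoc; ++-identityʳ; ≡-dec)
open import Data.List.Relation.Unary.Any using (Any; here; there; any?; satisfied)
import Data.List.Relation.Unary.Any as Any
open import Data.List.Relation.Unary.Any.Properties using (map⁺)
open import Data.List.Relation.Binary.Sublist.Propositional using (_⊆_; []; _∷_; _∷ʳ_; ⊆-refl; ⊆-reflexive; ⊆-trans; minimum)
open import Data.List.Relation.Binary.Sublist.Propositional.Properties using (++⁺; ++⁻; length-mono-≤; ∷⁻)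
open import Data.Product using (Σ; _×_; _,_; ∃-syntax)
open import Data.Sum using (_⊎_; inj₁; inj₂)
open import Data.Empty using (⊥-elim)
open import Function using (case_of_)
open import Relation.Binary.PropositionalEquality
open import Relation.Nullary using (¬_; yes; no; Dec)
open import Relation.Nullary.Decidable using (map′)

private variable
  m d : ℕ
  x y z : Seq

-- Edits and subsequences

length-insert : ∀ (u v : Seq) b → length (u ++ b ∷ v) ≡ suc (length (u ++ v))
length-insert u v b = begin
  length (u ++ b ∷ v)        ≡⟨ length-++ u ⟩
  length u + suc (length v)  ≡⟨ +-suc (length u) (length v) ⟩
  suc (length u + length v)  ≡⟨ cong suc (length-++ u) ⟨
  suc (length (u ++ v))      ∎
  where open ≡-Reasoning

edit-length : Edit x y → length x ≤ suc (length y)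
edit-length (ins u v b) rewrite length-insert u v b = m≤n⇒m≤1+n (n≤1+n _)
edit-length (del u v b) rewrite length-insert u v b = ≤-refl
edit-length (sub u v a b) rewrite length-insert u v a | length-insert u v b = n≤1+n _

edits-length : Edits m x y → length x ≤ length y + m
edits-length none = m≤m+n _ 0
edits-length {suc m} {x} {z} (step {y = y} e es) = begin
  length x            ≤⟨ edit-length e ⟩
  suc (length y)      ≤⟨ s≤s (edits-length es) ⟩
  suc (length z + m)  ≡⟨ +-suc (length z) m ⟨
  length z + suc m    ∎
  where open ≤-Reasoning

shortening-edit⇒⊆ : Edit x y → length x ≡ suc (length y) → y ⊆ x
shortening-edit⇒⊆ (ins u v b) eq rewrite length-insert u v b = ⊥-elim (1+n≰n (≤-trans (≤-reflexive (sym eq)) (n≤1+n _)))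
shortening-edit⇒⊆ (del u v b) eq = ++⁺ (⊆-refl {x = u}) (b ∷ʳ ⊆-refl)
shortening-edit⇒⊆ (sub u v a b) eq rewrite length-insert u v a | length-insert u v b = ⊥-elim (1+n≰n (≤-reflexive (sym eq)))

-- Each edit shortens by at most one, so the length budget forces every edit to be a deletion.
shortening-edits⇒⊆ : Edits m x y → length x ≡ length y + m → y ⊆ x
shortening-edits⇒⊆ none eq = ⊆-refl
shortening-edits⇒⊆ {suc m} {x} {z} (step {y = y} e es) eq =
  ⊆-trans (shortening-edits⇒⊆ es y≡) (shortening-edit⇒⊆ e (trans eq (trans (+-suc _ m) (cong suc (sym y≡)))))
  where
    y≡ : length y ≡ length z + m
    y≡ = ≤-antisym (edits-length es)
           (≤-pred (≤-trans (≤-reflexive (trans (sym (+-suc _ m)) (sym eq))) (edit-length e)))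

edit-∷ : ∀ a → Edit x y → Edit (a ∷ x) (a ∷ y)
edit-∷ a (ins u v b) = ins (a ∷ u) v b
edit-∷ a (del u v b) = del (a ∷ u) v b
edit-∷ a (sub u v c b) = sub (a ∷ u) v c b

edits-∷ : ∀ a → Edits m x y → Edits m (a ∷ x) (a ∷ y)
edits-∷ a none = none
edits-∷ a (step e es) = step (edit-∷ a e) (edits-∷ a es)

⊆⇒deletions : y ⊆ x → Edits (length x ∸ length y) x y
⊆⇒deletions [] = none
⊆⇒deletions {y} {a ∷ x} (.a ∷ʳ y⊆x) =
  subst (λ k → Edits k (a ∷ x) y) (sym (+-∸-assoc 1 (length-mono-≤ y⊆x)))
    (step (del [] x a) (⊆⇒deletions y⊆x))
⊆⇒deletions (refl ∷ y⊆x) = edits-∷ _ (⊆⇒deletions y⊆x)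

⊆⇒levDist : y ⊆ x → IsLevDist x y (length x ∸ length y)
⊆⇒levDist {y} {x} y⊆x = ⊆⇒deletions y⊆x , λ m es → m≤n+o⇒m∸n≤o (length x) (length y) (edits-length es)

edits-zero : Edits 0 x y → x ≡ y
edits-zero none = refl

levDist⇒⊆ : IsLevDist x y d → d ≡ length x ∸ length y → y ⊆ x
levDist⇒⊆ {x} {y} (es , _) d≡ with length y ≤? length x
... | yes y≤x = shortening-edits⇒⊆ es (trans (sym (m+[n∸m]≡n y≤x)) (cong (length y +_) (sym d≡)))
... | no y≰x = ⊆-reflexive (sym (edits-zero (subst (λ k → Edits k x y) d≡0 es)))
  where d≡0 = trans d≡ (m≤n⇒m∸n≡0 (<⇒≤ (≰⇒> y≰x)))

oneEditNeighbours : (x : Seq) → List (Σ Seq (Edit x))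
oneEditNeighbours [] = (true ∷ [] , ins [] [] true) ∷ (false ∷ [] , ins [] [] false) ∷ []
oneEditNeighbours (a ∷ x) =
  (true ∷ a ∷ x , ins [] (a ∷ x) true) ∷ (false ∷ a ∷ x , ins [] (a ∷ x) false) ∷
  (x , del [] x a) ∷ (true ∷ x , sub [] x a true) ∷ (false ∷ x , sub [] x a false) ∷
  map (λ (y , e) → a ∷ y , edit-∷ a e) (oneEditNeighbours x)

IsNeighbour : Seq → Seq → Set
IsNeighbour x y = Any (λ (z , _) → z ≡ y) (oneEditNeighbours x)

isNeighbour-∷ : ∀ a → IsNeighbour x y → IsNeighbour (a ∷ x) (a ∷ y)
isNeighbour-∷ a n = there (there (there (there (there (map⁺ (Any.map (cong (a ∷_)) n))))))

edit⇒isNeighbour : Edit x y → IsNeighbour x y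
edit⇒isNeighbour (ins [] [] true) = here refl
edit⇒isNeighbour (ins [] [] false) = there (here refl)
edit⇒isNeighbour (ins [] (a ∷ v) true) = here refl
edit⇒isNeighbour (ins [] (a ∷ v) false) = there (here refl)
edit⇒isNeighbour (ins (a ∷ u) v b) = isNeighbour-∷ a (edit⇒isNeighbour (ins u v b))
edit⇒isNeighbour (del [] v b) = there (there (here refl))
edit⇒isNeighbour (del (a ∷ u) v b) = isNeighbour-∷ a (edit⇒isNeighbour (del u v b))
edit⇒isNeighbour (sub [] v a true) = there (there (there (here refl)))
edit⇒isNeighbour (sub [] v a false) = there (there (there (there (here refl))))
edit⇒isNeighbour (sub (c ∷ u) v a b) = isNeighbour-∷ c (edit⇒isNeighbour (sub u v a b))

edits? : ∀ m x y → Dec (Edits m x y)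
edits? zero x y = map′ (λ { refl → none }) edits-zero (≡-dec Bool._≟_ x y)
edits? (suc m) x z = map′ fromNeighbour toNeighbour (any? (λ (y , _) → edits? m y z) (oneEditNeighbours x))
  where
    fromNeighbour : Any (λ (y , _) → Edits m y z) (oneEditNeighbours x) → Edits (suc m) x z
    fromNeighbour n = let ((_ , e) , es) = satisfied n in step e es
    toNeighbour : Edits (suc m) x z → Any (λ (y , _) → Edits m y z) (oneEditNeighbours x)
    toNeighbour (step e es) = Any.map (λ { refl → es }) (edit⇒isNeighbour e)

least : {P : ℕ → Set} → (∀ m → Dec (P m)) → ∀ n → P n → ∃[ d ] P d × (∀ m → P m → d ≤ m)
least {P} P? = <-rec (λ n → P n → ∃[ d ] P d × (∀ m → P m → d ≤ m)) λ n rec Pn →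
  case anyUpTo? P? n of λ where
    (yes (m , m<n , Pm)) → rec m<n Pm
    (no ¬smaller) → n , Pn , λ m Pm → ≮⇒≥ (λ m<n → ¬smaller (m , m<n , Pm))

_++ᴱ_ : ∀ {k} → Edits m x y → Edits k y z → Edits (m + k) x z
none ++ᴱ es′ = es′
step e es ++ᴱ es′ = step e (es ++ᴱ es′)

insertions : ∀ y → Edits (length y) [] y
insertions [] = none
insertions (b ∷ y) = step (ins [] [] b) (edits-∷ b (insertions y))

levDist-exists : ∀ x y → ∃[ d ] IsLevDist x y d
levDist-exists x y = least (λ m → edits? m x y) _ (⊆⇒deletions (minimum x) ++ᴱ insertions y)

-- Search with subsequence tests

Within : ℕ → Seq → Alg → Seq → ℕ → Set
Within n s A o w = ∃[ m ] Runs n s A o m × 2 ^ m ≤ w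

within-mono : ∀ {n s A o w w′} → w ≤ w′ → Within n s A o w → Within n s A o w′
within-mono w≤w′ (m , run , bound) = m , run , ≤-trans bound w≤w′

output-within : ∀ {n s o} → Within n s (output o) o 1
output-within = 0 , done , ≤-refl

branch : {P : Set} → Dec P → Alg → Alg → Alg
branch (yes _) A B = A
branch (no _) A B = B

subseqTest : ℕ → Seq → Alg → Alg → Alg
subseqTest ℓ q A B = query q (λ d → branch (d ≟ ℓ ∸ length q) A B)

module _ {n : ℕ} {s q : Seq} {A B : Alg} {o : Seq} {w : ℕ} (q≤n : length q ≤ n) where

  subseqTest-⊆ : q ⊆ s → Within n s A o w → Within n s (subseqTest (length s) q A B) o (2 * w)
  subseqTest-⊆ q⊆s (m , run , bound) = suc m , ask q≤n (⊆⇒levDist q⊆s) run′ , *-monoʳ-≤ 2 bound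
    where
      gap : ℕ
      gap = length s ∸ length q
      run′ : Runs n s (branch (gap ≟ gap) A B) o m
      run′ with gap ≟ gap
      ... | yes _ = run
      ... | no gap≢gap = ⊥-elim (gap≢gap refl)

  subseqTest-⊈ : ¬ q ⊆ s → Within n s B o w → Within n s (subseqTest (length s) q A B) o (2 * w)
  subseqTest-⊈ q⊈s (m , run , bound) with levDist-exists s q
  ... | d , dist = suc m , ask q≤n dist run′ , *-monoʳ-≤ 2 bound
    where
      run′ : Runs n s (branch (d ≟ length s ∸ length q) A B) o m
      run′ with d ≟ length s ∸ length q
      ... | yes d≡ = ⊥-elim (q⊈s (levDist⇒⊆ dist d≡))
      ... | no _ = run

Tester : Set
Tester = ℕ → Alg → Alg → Alg

record IsThresholdTest (n : ℕ) (s : Seq) (t : Tester) (r : ℕ) : Set where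
  field
    accept : ∀ {j A B o w} → j ≤ r → Within n s A o w → Within n s (t j A B) o (2 * w)
    reject : ∀ {j A B o w} → r < j → Within n s B o w → Within n s (t j A B) o (2 * w)

-- Thresholds above R are rejected without asking, so that no query exceeds the length bound.
cappedTest : ℕ → ℕ → (ℕ → Seq) → Tester
cappedTest ℓ R Q j A B with j ≤? R
... | yes _ = subseqTest ℓ (Q j) A B
... | no _ = B

cappedTest-isThresholdTest : ∀ {n s} (Q : ℕ → Seq) {R r} →
  (∀ j → j ≤ R → length (Q j) ≤ n) → (∀ j → j ≤ r → Q j ⊆ s) → (∀ j → Q j ⊆ s → j ≤ r) → r ≤ R →
  IsThresholdTest n s (cappedTest (length s) R Q) r
cappedTest-isThresholdTest {n} {s} Q {R} {r} Q≤n sound complete r≤R = record { accept = accept ; reject = reject }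
  where
    accept : ∀ {j A B o w} → j ≤ r → Within n s A o w → Within n s (cappedTest (length s) R Q j A B) o (2 * w)
    accept {j} j≤r run with j ≤? R
    ... | yes j≤R = subseqTest-⊆ (Q≤n j j≤R) (sound j j≤r) run
    ... | no j≰R = ⊥-elim (j≰R (≤-trans j≤r r≤R))
    reject : ∀ {j A B o w} → r < j → Within n s B o w → Within n s (cappedTest (length s) R Q j A B) o (2 * w)
    reject {j} r<j run with j ≤? R
    ... | yes j≤R = subseqTest-⊈ (Q≤n j j≤R) (λ Qj⊆s → <⇒≱ r<j (complete j Qj⊆s)) run
    ... | no _ = within-mono (m≤m+n _ _) run

bisect : Tester → ℕ → ℕ → (ℕ → Alg) → Alg
bisect t zero lo κ = κ lo
bisect t (suc a) lo κ = t (lo + 2 ^ a) (bisect t a (lo + 2 ^ a) κ) (bisect t a lo κ)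

gallop : Tester → ℕ → ℕ → (ℕ → Alg) → Alg
gallop t zero a κ = bisect t a (2 ^ a) κ
gallop t (suc f) a κ = t (2 ^ suc a) (gallop t f (suc a) κ) (bisect t a (2 ^ a) κ)

2^suc≡2^+2^ : ∀ a → 2 ^ suc a ≡ 2 ^ a + 2 ^ a
2^suc≡2^+2^ a = cong (2 ^ a +_) (+-identityʳ (2 ^ a))

suc≤double : ∀ {x} → 1 ≤ x → suc x ≤ x + x
suc≤double {x} 1≤x = ≤-trans (≤-reflexive (+-comm 1 x)) (+-monoʳ-≤ x 1≤x)

octave-charge : ∀ a m w {r} → 2 ^ a ≤ r → 2 ^ m ≤ 2 * (2 ^ a * w) → 2 ^ a * 2 ^ m ≤ 2 * (r * r) * w
octave-charge a m w {r} 2^a≤r bound = begin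
  2 ^ a * 2 ^ m                ≤⟨ *-monoʳ-≤ (2 ^ a) bound ⟩
  2 ^ a * (2 * (2 ^ a * w))    ≡⟨ regroup (2 ^ a) w ⟩
  2 * (2 ^ a * 2 ^ a) * w      ≤⟨ *-monoˡ-≤ w (*-monoʳ-≤ 2 (*-mono-≤ 2^a≤r 2^a≤r)) ⟩
  2 * (r * r) * w              ∎
  where
    open ≤-Reasoning
    regroup : ∀ x w → x * (2 * (x * w)) ≡ 2 * (x * x) * w
    regroup = solve-∀

module Search {n : ℕ} {s : Seq} {t : Tester} {r : ℕ} (isTest : IsThresholdTest n s t r) where
  open IsThresholdTest isTest

  bisect-within : ∀ a {lo κ o w} → lo ≤ r → r < lo + 2 ^ a →
    Within n s (κ r) o w → Within n s (bisect t a lo κ) o (2 ^ a * w)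
  bisect-within zero {lo} {w = w} lo≤r r<lo+1 run
    rewrite ≤-antisym (≤-pred (≤-trans r<lo+1 (≤-reflexive (+-comm lo 1)))) lo≤r =
    within-mono (≤-reflexive (sym (*-identityˡ w))) run
  bisect-within (suc a) {lo} {w = w} lo≤r r<lo+2^sa run with lo + 2 ^ a ≤? r
  ... | yes mid≤r = within-mono (≤-reflexive (sym (*-assoc 2 (2 ^ a) w)))
                       (accept mid≤r (bisect-within a mid≤r r<mid+2^a run))
    where r<mid+2^a = ≤-trans r<lo+2^sa (≤-reflexive (trans (cong (lo +_) (2^suc≡2^+2^ a)) (sym (+-assoc lo _ _))))
  ... | no mid≰r = within-mono (≤-reflexive (sym (*-assoc 2 (2 ^ a) w)))
                     (reject (≰⇒> mid≰r) (bisect-within a lo≤r (≰⇒> mid≰r) run))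

  bisect-octave : ∀ a {κ o w} → 2 ^ a ≤ r → r < 2 ^ suc a →
    Within n s (κ r) o w → Within n s (bisect t a (2 ^ a) κ) o (2 ^ a * w)
  bisect-octave a 2^a≤r r<2^sa = bisect-within a 2^a≤r (≤-trans r<2^sa (≤-reflexive (2^suc≡2^+2^ a)))

  -- Locating r ∈ [2^b, 2^(b+1)) from 2^a costs (b − a) + 1 + b queries, hence the factor 2^a on the left.
  gallop-charge : ∀ f a {κ o w} → 2 ^ a ≤ r → r ≤ 2 ^ a + f → Within n s (κ r) o w →
    ∃[ m ] Runs n s (gallop t f a κ) o m × 2 ^ a * 2 ^ m ≤ 2 * (r * r) * w
  gallop-charge zero a {w = w} 2^a≤r r≤2^a+0 run =
    let m , run′ , bound = bisect-octave a 2^a≤r r<2^sa run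
    in m , run′ , octave-charge a m w 2^a≤r (≤-trans bound (m≤m+n _ _))
    where
      r<2^sa : r < 2 ^ suc a
      r<2^sa = ≤-trans (s≤s (≤-trans r≤2^a+0 (≤-reflexive (+-identityʳ _))))
                 (≤-trans (suc≤double (m^n>0 2 a)) (≤-reflexive (sym (2^suc≡2^+2^ a))))
  gallop-charge (suc f) a {w = w} 2^a≤r r≤2^a+sf run with 2 ^ suc a ≤? r
  ... | yes 2^sa≤r =
    let m , run′ , charge = gallop-charge f (suc a) 2^sa≤r r≤2^sa+f run
        m′ , run″ , bound = accept 2^sa≤r (m , run′ , ≤-refl)
    in m′ , run″ , (begin
      2 ^ a * 2 ^ m′         ≤⟨ *-monoʳ-≤ (2 ^ a) bound ⟩
      2 ^ a * (2 * 2 ^ m)    ≡⟨ *-assoc (2 ^ a) 2 (2 ^ m) ⟨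
      2 ^ a * 2 * 2 ^ m      ≡⟨ cong (_* 2 ^ m) (*-comm (2 ^ a) 2) ⟩
      2 ^ suc a * 2 ^ m      ≤⟨ charge ⟩
      2 * (r * r) * w        ∎)
    where
      open ≤-Reasoning
      r≤2^sa+f : r ≤ 2 ^ suc a + f
      r≤2^sa+f = begin
        r                    ≤⟨ r≤2^a+sf ⟩
        2 ^ a + suc f        ≡⟨ +-suc (2 ^ a) f ⟩
        suc (2 ^ a) + f      ≤⟨ +-monoˡ-≤ f (suc≤double (m^n>0 2 a)) ⟩
        2 ^ a + 2 ^ a + f    ≡⟨ cong (_+ f) (2^suc≡2^+2^ a) ⟨
        2 ^ suc a + f        ∎
  ... | no 2^sa≰r =
    let m , run′ , bound = reject (≰⇒> 2^sa≰r) (bisect-octave a 2^a≤r (≰⇒> 2^sa≰r) run)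
    in m , run′ , octave-charge a m w 2^a≤r bound

  gallop-within : ∀ {f κ o w} → 1 ≤ r → r ≤ suc f → Within n s (κ r) o w →
    Within n s (gallop t f 0 κ) o (2 * (r * r) * w)
  gallop-within {f} 1≤r r≤sf run =
    let m , run′ , charge = gallop-charge f 0 1≤r r≤sf run
    in m , run′ , ≤-trans (≤-reflexive (sym (*-identityˡ (2 ^ m)))) charge

-- Runs

count : Bool → Seq → ℕ
count c [] = 0
count c (a ∷ t) = (if eqB c a then 1 else 0) + count c t

leadRun : Bool → Seq → ℕ
leadRun c [] = 0
leadRun c (a ∷ t) = if eqB c a then suc (leadRun c t) else 0

dropRun : Bool → Seq → Seq
dropRun c [] = []
dropRun c (a ∷ t) = if eqB c a then dropRun c t else a ∷ t

data Begins (c : Bool) : Seq → Set where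
  nil  : Begins c []
  cons : ∀ t → Begins c (c ∷ t)

eqB-refl : ∀ c → eqB c c ≡ true
eqB-refl true = refl
eqB-refl false = refl

count-++ : ∀ c x y → count c (x ++ y) ≡ count c x + count c y
count-++ c [] y = refl
count-++ c (a ∷ x) y = trans (cong (_ +_) (count-++ c x y)) (sym (+-assoc (if eqB c a then 1 else 0) _ _))

count-replicate : ∀ c j → count c (replicate j c) ≡ j
count-replicate c zero = refl
count-replicate c (suc j) rewrite eqB-refl c = cong suc (count-replicate c j)

count-replicate-not : ∀ c j → count (not c) (replicate j c) ≡ 0
count-replicate-not true zero = refl
count-replicate-not true (suc j) = count-replicate-not true j
count-replicate-not false zero = refl
count-replicate-not false (suc j) = count-replicate-not false j

length≡count+count : ∀ c t → length t ≡ count c t + count (not c) t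
length≡count+count c [] = refl
length≡count+count true (true ∷ t) = cong suc (length≡count+count true t)
length≡count+count true (false ∷ t) = trans (cong suc (length≡count+count true t)) (sym (+-suc _ _))
length≡count+count false (true ∷ t) = trans (cong suc (length≡count+count false t)) (sym (+-suc _ _))
length≡count+count false (false ∷ t) = cong suc (length≡count+count false t)

count-mono : ∀ c → x ⊆ y → count c x ≤ count c y
count-mono c [] = z≤n
count-mono c (a ∷ʳ x⊆y) = ≤-trans (count-mono c x⊆y) (m≤n+m _ _)
count-mono c (refl ∷ x⊆y) = +-monoʳ-≤ _ (count-mono c x⊆y)

replicate-count-⊆ : ∀ c t → replicate (count c t) c ⊆ t
replicate-count-⊆ c [] = []
replicate-count-⊆ true (true ∷ t) = refl ∷ replicate-count-⊆ true t
replicate-count-⊆ true (false ∷ t) = false ∷ʳ replicate-count-⊆ true t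
replicate-count-⊆ false (true ∷ t) = true ∷ʳ replicate-count-⊆ false t
replicate-count-⊆ false (false ∷ t) = refl ∷ replicate-count-⊆ false t

replicate-mono : ∀ (c : Bool) {j k} → j ≤ k → replicate j c ⊆ replicate k c
replicate-mono c {zero} {k} _ = minimum (replicate k c)
replicate-mono c (s≤s j≤k) = refl ∷ replicate-mono c j≤k

leadRun≤count : ∀ c t → leadRun c t ≤ count c t
leadRun≤count c [] = z≤n
leadRun≤count true (true ∷ t) = s≤s (leadRun≤count true t)
leadRun≤count true (false ∷ t) = z≤n
leadRun≤count false (true ∷ t) = z≤n
leadRun≤count false (false ∷ t) = s≤s (leadRun≤count false t)

split-leadRun : ∀ c t → t ≡ replicate (leadRun c t) c ++ dropRun c t
split-leadRun c [] = refl
split-leadRun true (true ∷ t) = cong (true ∷_) (split-leadRun true t)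
split-leadRun true (false ∷ t) = refl
split-leadRun false (true ∷ t) = refl
split-leadRun false (false ∷ t) = cong (false ∷_) (split-leadRun false t)

length-split-leadRun : ∀ c t → length t ≡ leadRun c t + length (dropRun c t)
length-split-leadRun c t = trans (cong length (split-leadRun c t))
  (trans (length-++ (replicate (leadRun c t) c)) (cong (_+ length (dropRun c t)) (length-replicate (leadRun c t))))

dropRun-begins : ∀ c t → Begins (not c) (dropRun c t)
dropRun-begins c [] = nil
dropRun-begins true (true ∷ t) = dropRun-begins true t
dropRun-begins true (false ∷ t) = cons t
dropRun-begins false (true ∷ t) = cons t
dropRun-begins false (false ∷ t) = dropRun-begins false t

begins⇒leadRun : ∀ c a t → Begins c (a ∷ t) → 1 ≤ leadRun c (a ∷ t)
begins⇒leadRun c .c t (cons .t) rewrite eqB-refl c = s≤s z≤n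

begins-true-or-false : ∀ t → (1 ≤ leadRun true t × Begins true t) ⊎ (leadRun true t < 1 × Begins false t)
begins-true-or-false [] = inj₂ (s≤s z≤n , nil)
begins-true-or-false (true ∷ t) = inj₁ (s≤s z≤n , cons t)
begins-true-or-false (false ∷ t) = inj₂ (s≤s z≤n , cons t)

runs-replicate : ∀ c r t → Begins (not c) t → runs (replicate (suc r) c ++ t) ≡ suc (runs t)
runs-replicate c zero .[] nil = refl
runs-replicate true zero .(false ∷ t) (cons t) = refl
runs-replicate false zero .(true ∷ t) (cons t) = refl
runs-replicate c (suc r) t b rewrite eqB-refl c = runs-replicate c r t b

runs-split-leadRun : ∀ c t → 1 ≤ leadRun c t → runs t ≡ suc (runs (dropRun c t))
runs-split-leadRun c t 1≤r with leadRun c t | split-leadRun c t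
... | suc r | t≡ = trans (cong runs t≡) (runs-replicate c r _ (dropRun-begins c t))

probe : Bool → ℕ → ℕ → Seq
probe c j k = replicate j c ++ replicate k (not c)

count-probe : ∀ c j k → count (not c) (probe c j k) ≡ k
count-probe c j k = trans (count-++ (not c) (replicate j c) _)
  (cong₂ _+_ (count-replicate-not c j) (count-replicate (not c) k))

length-probe : ∀ c j k → length (probe c j k) ≡ j + k
length-probe c j k = trans (length-++ (replicate j c)) (cong₂ _+_ (length-replicate j) (length-replicate k))

≤leadRun⇒probe-⊆ : ∀ c j t → j ≤ leadRun c t → probe c j (count (not c) t) ⊆ t
≤leadRun⇒probe-⊆ c zero t _ = replicate-count-⊆ (not c) t
≤leadRun⇒probe-⊆ true (suc j) (true ∷ t) (s≤s j≤r) = refl ∷ ≤leadRun⇒probe-⊆ true j t j≤r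
≤leadRun⇒probe-⊆ false (suc j) (false ∷ t) (s≤s j≤r) = refl ∷ ≤leadRun⇒probe-⊆ false j t j≤r

probe-⊆⇒≤leadRun : ∀ c j t → probe c j (count (not c) t) ⊆ t → j ≤ leadRun c t
probe-⊆⇒≤leadRun c zero t _ = z≤n
probe-⊆⇒≤leadRun true (suc j) (true ∷ t) p⊆t = s≤s (probe-⊆⇒≤leadRun true j t (∷⁻ p⊆t))
probe-⊆⇒≤leadRun false (suc j) (false ∷ t) p⊆t = s≤s (probe-⊆⇒≤leadRun false j t (∷⁻ p⊆t))
probe-⊆⇒≤leadRun true (suc j) (false ∷ t) (.false ∷ʳ p⊆t) =
  ⊥-elim (1+n≰n (≤-trans (≤-reflexive (sym (count-probe true (suc j) _))) (count-mono false p⊆t)))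
probe-⊆⇒≤leadRun false (suc j) (true ∷ t) (.true ∷ʳ p⊆t) =
  ⊥-elim (1+n≰n (≤-trans (≤-reflexive (sym (count-probe false (suc j) _))) (count-mono true p⊆t)))

runCost : List ℕ → ℕ
runCost [] = 1
runCost (r ∷ rs) = 2 * (r * r) * runCost rs

-- ℓ and N₁ are the length and the number of ones of the hidden sequence; p is the prefix
-- recovered so far and c the symbol of the next run.
module RunByRun (ℓ N₁ : ℕ) where

  total : Bool → ℕ
  total true = N₁
  total false = ℓ ∸ N₁

  runTest : Seq → Bool → Tester
  runTest p c = cappedTest ℓ (total c ∸ count c p) (λ j → p ++ probe c j (total (not c) ∸ count (not c) p))

  loop : ℕ → Seq → Bool → Alg
  loop zero p c = output p
  loop (suc f) p c with ℓ ≤? length p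
  ... | yes _ = output p
  ... | no _ = gallop (runTest p c) (total c ∸ count c p) 0 (λ r → loop f (p ++ replicate r c) (not c))

  start : Alg
  start = runTest [] true 1 (loop ℓ [] true) (loop ℓ [] false)

module RunByRunCorrect (n : ℕ) (s : Seq) (s≤n : length s ≤ n) where
  open RunByRun (length s) (count true s)

  total≡count : ∀ c → total c ≡ count c s
  total≡count true = refl
  total≡count false = begin
    length s ∸ count true s                        ≡⟨ cong (_∸ count true s) (length≡count+count true s) ⟩
    count true s + count false s ∸ count true s    ≡⟨ m+n∸m≡n (count true s) _ ⟩
    count false s                                  ∎
    where open ≡-Reasoning

  remaining : ∀ c p t → s ≡ p ++ t → total c ∸ count c p ≡ count c t
  remaining c p t s≡ = begin
    total c ∸ count c p                   ≡⟨ cong (_∸ count c p) (trans (total≡count c) (cong (count c) s≡)) ⟩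
    count c (p ++ t) ∸ count c p          ≡⟨ cong (_∸ count c p) (count-++ c p t) ⟩
    count c p + count c t ∸ count c p     ≡⟨ m+n∸m≡n (count c p) _ ⟩
    count c t                             ∎
    where open ≡-Reasoning

  runTest-isThresholdTest : ∀ {p t} c → s ≡ p ++ t → IsThresholdTest n s (runTest p c) (leadRun c t)
  runTest-isThresholdTest {p} {t} c s≡ =
    subst (λ k → IsThresholdTest n s (cappedTest (length s) k Q) (leadRun c t)) (sym (remaining c p t s≡))
      (cappedTest-isThresholdTest Q Q≤n sound complete (leadRun≤count c t))
    where
      Q : ℕ → Seq
      Q j = p ++ probe c j (total (not c) ∸ count (not c) p)
      Q≡ : ∀ j → Q j ≡ p ++ probe c j (count (not c) t)
      Q≡ j = cong (λ k → p ++ probe c j k) (remaining (not c) p t s≡)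
      Q≤n : ∀ j → j ≤ count c t → length (Q j) ≤ n
      Q≤n j j≤ = begin
        length (Q j)                                ≡⟨ cong length (Q≡ j) ⟩
        length (p ++ probe c j (count (not c) t))   ≡⟨ length-++ p ⟩
        length p + length (probe c j _)             ≡⟨ cong (length p +_) (length-probe c j _) ⟩
        length p + (j + count (not c) t)            ≤⟨ +-monoʳ-≤ (length p) (+-monoˡ-≤ _ j≤) ⟩
        length p + (count c t + count (not c) t)    ≡⟨ cong (length p +_) (length≡count+count c t) ⟨
        length p + length t                         ≡⟨ length-++ p ⟨
        length (p ++ t)                             ≡⟨ cong length s≡ ⟨
        length s                                    ≤⟨ s≤n ⟩
        n                                           ∎
        where open ≤-Reasoning
      sound : ∀ j → j ≤ leadRun c t → Q j ⊆ s
      sound j j≤r = subst₂ _⊆_ (sym (Q≡ j)) (sym s≡) (++⁺ ⊆-refl (≤leadRun⇒probe-⊆ c j t j≤r))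
      complete : ∀ j → Q j ⊆ s → j ≤ leadRun c t
      complete j Qj⊆s = probe-⊆⇒≤leadRun c j t (++⁻ {as = p} refl (subst₂ _⊆_ (Q≡ j) s≡ Qj⊆s))

  loop-done : ∀ f {p c} → s ≡ p ++ [] → Within n s (loop f p c) s 1
  loop-done f {p} s≡ with s≡p ← trans s≡ (++-identityʳ p) | f
  ... | zero = subst (λ p → Within n s (output p) s 1) s≡p output-within
  ... | suc f with length s ≤? length p
  ...   | yes _ = subst (λ p → Within n s (output p) s 1) s≡p output-within
  ...   | no s≰p = ⊥-elim (s≰p (≤-reflexive (cong length s≡p)))

  loop-step : ∀ f {p t c w} → s ≡ p ++ t → 1 ≤ leadRun c t →
    Within n s (loop f (p ++ replicate (leadRun c t) c) (not c)) s w →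
    Within n s (loop (suc f) p c) s (2 * (leadRun c t * leadRun c t) * w)
  loop-step f {p} {a ∷ t₀} {c} s≡ 1≤r run with length s ≤? length p
  ... | yes s≤p = ⊥-elim (m+1+n≰m (length p) (≤-trans (≤-reflexive p+t≡s) s≤p))
    where p+t≡s = trans (sym (length-++ p)) (cong length (sym s≡))
  ... | no _ = Search.gallop-within (runTest-isThresholdTest c s≡) 1≤r r≤1+R run
    where
      r≤1+R : leadRun c (a ∷ t₀) ≤ suc (total c ∸ count c p)
      r≤1+R = m≤n⇒m≤1+n (≤-trans (leadRun≤count c (a ∷ t₀)) (≤-reflexive (sym (remaining c p (a ∷ t₀) s≡))))

  RecoversAtRunCost : Alg → Seq → Set
  RecoversAtRunCost A t = ∃[ rs ] length rs ≡ runs t × sum rs ≡ length t × Within n s A s (runCost rs)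

  loop-correct : ∀ f p t c → s ≡ p ++ t → length t ≤ f → Begins c t → RecoversAtRunCost (loop f p c) t
  loop-correct f p [] c s≡ _ _ = [] , refl , refl , loop-done f s≡
  loop-correct (suc f) p t@(a ∷ t₀) c s≡ t≤1+f begins =
    let rs , rs-length , rs-sum , run = loop-correct f (p ++ replicate r c) rest (not c) s≡′ rest≤f (dropRun-begins c t)
    in r ∷ rs , trans (cong suc rs-length) (sym (runs-split-leadRun c t 1≤r)) ,
       trans (cong (r +_) rs-sum) (sym (length-split-leadRun c t)) ,
       loop-step f s≡ 1≤r run
    where
      r = leadRun c t
      rest = dropRun c t
      1≤r : 1 ≤ r
      1≤r = begins⇒leadRun c a t₀ begins
      s≡′ : s ≡ (p ++ replicate r c) ++ rest
      s≡′ = trans s≡ (trans (cong (p ++_) (split-leadRun c t)) (sym (++-assoc p _ rest)))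
      rest≤f : length rest ≤ f
      rest≤f = ≤-pred (≤-trans (+-monoˡ-≤ (length rest) 1≤r)
                 (≤-trans (≤-reflexive (sym (length-split-leadRun c t))) t≤1+f))

  firstSymbol : IsThresholdTest n s (runTest [] true) (leadRun true s)
  firstSymbol = runTest-isThresholdTest {[]} {s} true refl

  start-correct : ∃[ rs ] length rs ≡ runs s × sum rs ≡ length s × Within n s start s (2 * runCost rs)
  start-correct with begins-true-or-false s
  ... | inj₁ (1≤r , begins) = let rs , rs-length , rs-sum , run = loop-correct (length s) [] s true refl ≤-refl begins
                              in rs , rs-length , rs-sum , IsThresholdTest.accept firstSymbol 1≤r run
  ... | inj₂ (r<1 , begins) = let rs , rs-length , rs-sum , run = loop-correct (length s) [] s false refl ≤-refl begins
                              in rs , rs-length , rs-sum , IsThresholdTest.reject firstSymbol r<1 run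

-- AM–GM and the query bound

^-distribʳ-* : ∀ a b k → (a * b) ^ k ≡ a ^ k * b ^ k
^-distribʳ-* a b zero = refl
^-distribʳ-* a b (suc k) rewrite ^-distribʳ-* a b k = interchange a b (a ^ k) (b ^ k)
  where
    interchange : ∀ a b x y → a * b * (x * y) ≡ a * x * (b * y)
    interchange = solve-∀

2*a*b≤a*a+b*b : ∀ a b → 2 * a * b ≤ a * a + b * b
2*a*b≤a*a+b*b a b with ≤-total a b
... | inj₁ a≤b with d , refl ← m≤n⇒∃[o]m+o≡n a≤b =
  ≤-trans (m≤m+n (2 * a * (a + d)) (d * d)) (≤-reflexive (square-gap a d))
  where
    square-gap : ∀ a d → 2 * a * (a + d) + d * d ≡ a * a + (a + d) * (a + d)
    square-gap = solve-∀
... | inj₂ b≤a with d , refl ← m≤n⇒∃[o]m+o≡n b≤a =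
  ≤-trans (m≤m+n (2 * (b + d) * b) (d * d)) (≤-reflexive (square-gap b d))
  where
    square-gap : ∀ b d → 2 * (b + d) * b + d * d ≡ (b + d) * (b + d) + b * b
    square-gap = solve-∀

weighted-amgm : ∀ k α β → suc k * α * β ^ k ≤ α ^ suc k + k * β ^ suc k
weighted-amgm zero α β = ≤-reflexive (base α)
  where
    base : ∀ α → 1 * α * 1 ≡ α * 1 + 0 * (β * 1)
    base = solve-∀
weighted-amgm (suc k) α β = +-cancelˡ-≤ (k * (α * (β * b))) _ _ (begin
  k * (α * (β * b)) + suc (suc k) * α * (β * b)        ≡⟨ expand k α β b ⟩
  suc k * b * (2 * α * β)                              ≤⟨ *-monoʳ-≤ (suc k * b) (2*a*b≤a*a+b*b α β) ⟩
  suc k * b * (α * α + β * β)                          ≡⟨ redistribute k α β b ⟩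
  α * (suc k * α * b) + suc k * (β * (β * b))          ≤⟨ +-monoˡ-≤ _ (*-monoʳ-≤ α (weighted-amgm k α β)) ⟩
  α * (α * a + k * (β * b)) + suc k * (β * (β * b))    ≡⟨ collect k α β a b ⟩
  k * (α * (β * b)) + (α * (α * a) + suc k * (β * (β * b))) ∎)
  where
    open ≤-Reasoning
    a = α ^ k
    b = β ^ k
    expand : ∀ k α β b → k * (α * (β * b)) + suc (suc k) * α * (β * b) ≡ suc k * b * (2 * α * β)
    expand = solve-∀
    redistribute : ∀ k α β b → suc k * b * (α * α + β * β) ≡ α * (suc k * α * b) + suc k * (β * (β * b))
    redistribute = solve-∀
    collect : ∀ k α β a b →
      α * (α * a + k * (β * b)) + suc k * (β * (β * b)) ≡ k * (α * (β * b)) + (α * (α * a) + suc k * (β * (β * b)))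
    collect = solve-∀

-- Adding x to k numbers of sum S: weighted-amgm at α = k(x + S), β = (k + 1)S, divided by k.
amgm-step : ∀ k x S → suc k ^ suc k * x * S ^ k ≤ k ^ k * (x + S) ^ suc k
amgm-step zero x S = ≤-trans (≤-reflexive (unit x)) (≤-trans (m≤m+n x S) (≤-reflexive (unit′ (x + S))))
  where
    unit : ∀ x → 1 * 1 * x * 1 ≡ x
    unit = solve-∀
    unit′ : ∀ y → y ≡ 1 * (y * 1)
    unit′ = solve-∀
amgm-step (suc k′) x S = *-cancelˡ-≤ k (+-cancelʳ-≤ (k * (suc k * P * S * Q)) _ _ (begin
  k * (suc k * P * x * Q) + k * (suc k * P * S * Q)   ≡⟨ split-sum k x S P Q ⟨
  suc k * α * (P * Q)                                ≡⟨ cong (suc k * α *_) (^-distribʳ-* (suc k) S k) ⟨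
  suc k * α * β ^ k                                  ≤⟨ weighted-amgm k α β ⟩
  α * α ^ k + k * (β * β ^ k)                        ≡⟨ cong₂ (λ u v → α * u + k * (β * v)) (^-distribʳ-* k (x + S) k)
                                                                                          (^-distribʳ-* (suc k) S k) ⟩
  α * (U * V) + k * (β * (P * Q))                    ≡⟨ regroup k x S P Q U V ⟩
  k * (U * ((x + S) * V)) + k * (suc k * P * S * Q)  ∎))
  where
    open ≤-Reasoning
    k = suc k′
    P = suc k ^ k
    Q = S ^ k
    U = k ^ k
    V = (x + S) ^ k
    α = k * (x + S)
    β = suc k * S
    split-sum : ∀ k x S P Q → suc k * (k * (x + S)) * (P * Q) ≡ k * (suc k * P * x * Q) + k * (suc k * P * S * Q)
    split-sum = solve-∀
    regroup : ∀ k x S P Q U V →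
      k * (x + S) * (U * V) + k * (suc k * S * (P * Q)) ≡ k * (U * ((x + S) * V)) + k * (suc k * P * S * Q)
    regroup = solve-∀

k^k≢0 : ∀ k → NonZero (k ^ k)
k^k≢0 zero = _
k^k≢0 (suc k) = m^n≢0 (suc k) (suc k)

amgm : ∀ rs → length rs ^ length rs * product rs ≤ sum rs ^ length rs
amgm [] = ≤-refl
amgm (x ∷ rs) = *-cancelˡ-≤ (k ^ k) {{k^k≢0 k}} (begin
  k ^ k * (suc k ^ suc k * (x * product rs))   ≡⟨ interchange (suc k ^ suc k) (k ^ k) x (product rs) ⟩
  suc k ^ suc k * x * (k ^ k * product rs)     ≤⟨ *-monoʳ-≤ (suc k ^ suc k * x) (amgm rs) ⟩
  suc k ^ suc k * x * sum rs ^ k               ≤⟨ amgm-step k x (sum rs) ⟩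
  k ^ k * (x + sum rs) ^ suc k                 ∎)
  where
    open ≤-Reasoning
    k = length rs
    interchange : ∀ A B x P → B * (A * (x * P)) ≡ A * x * (B * P)
    interchange = solve-∀

runCost≡ : ∀ rs → runCost rs ≡ 2 ^ length rs * (product rs * product rs)
runCost≡ [] = refl
runCost≡ (r ∷ rs) rewrite runCost≡ rs = interchange r (2 ^ length rs) (product rs)
  where
    interchange : ∀ r T P → 2 * (r * r) * (T * (P * P)) ≡ 2 * T * (r * P * (r * P))
    interchange = solve-∀

^-double : ∀ a k → a ^ (2 * k) ≡ a ^ k * a ^ k
^-double a k = trans (^-distribˡ-+-* a k (k + 0)) (cong (λ j → a ^ k * a ^ j) (+-identityʳ k))

costBound⇒queryBound : ∀ n rs m → sum rs ≤ n → 2 ^ m ≤ 8 * n * runCost rs → QueryBound 3 n (length rs) m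
costBound⇒queryBound n rs m sum≤n bound = begin
  2 ^ m * k ^ (2 * k)                    ≤⟨ *-monoˡ-≤ _ bound ⟩
  8 * n * runCost rs * k ^ (2 * k)       ≡⟨ cong₂ (λ x y → 8 * n * x * y) (runCost≡ rs) (^-double k k) ⟩
  8 * n * (T * (P * P)) * (B * B)        ≡⟨ square-together n T P B ⟩
  8 * n * T * ((B * P) * (B * P))        ≤⟨ *-monoʳ-≤ (8 * n * T) (*-mono-≤ amgm′ amgm′) ⟩
  8 * n * T * (n ^ k * n ^ k)            ≡⟨ regroup n T (n ^ k) ⟩
  (n ^ k * n ^ k) * n ^ 1 * (T * 2 ^ 3)  ≡⟨ cong₂ _*_ (trans (cong (_* n ^ 1) (sym (^-double n k))) (sym (^-distribˡ-+-* n (2 * k) 1)))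
                                                    (sym (^-distribˡ-+-* 2 k 3)) ⟩
  n ^ (2 * k + 1) * 2 ^ (k + 3)          ∎
  where
    open ≤-Reasoning
    k = length rs
    T = 2 ^ k
    P = product rs
    B = k ^ k
    amgm′ : B * P ≤ n ^ k
    amgm′ = ≤-trans (amgm rs) (^-monoˡ-≤ k sum≤n)
    square-together : ∀ n T P B → 8 * n * (T * (P * P)) * (B * B) ≡ 8 * n * T * ((B * P) * (B * P))
    square-together = solve-∀
    regroup : ∀ n T A → 8 * n * T * (A * A) ≡ (A * A) * (n * 1) * (T * (2 * (2 * (2 * 1))))
    regroup = solve-∀

2^L-between : ∀ n → n ≥ 1 → ∃[ L ] n < 2 ^ L × 2 ^ L ≤ 2 * n
2^L-between 1 _ = 1 , s≤s (s≤s z≤n) , ≤-refl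
2^L-between (suc (suc n)) _ with L , n<2^L , 2^L≤2n ← 2^L-between (suc n) (s≤s z≤n) | suc (suc n) <? 2 ^ L
... | yes n<2^L′ = L , n<2^L′ , ≤-trans 2^L≤2n (*-monoʳ-≤ 2 (n≤1+n (suc n)))
... | no n≮2^L = suc L , n<2^sL , ≤-reflexive (cong (2 *_) (sym n≡2^L))
  where
    n≡2^L : suc (suc n) ≡ 2 ^ L
    n≡2^L = ≤-antisym n<2^L (≮⇒≥ n≮2^L)
    n<2^sL : suc (suc n) < 2 ^ suc L
    n<2^sL = ≤-trans (s≤s (≤-reflexive n≡2^L)) (≤-trans (suc≤double (m^n>0 2 L)) (≤-reflexive (sym (2^suc≡2^+2^ L))))

recover : ℕ → Alg
recover L = query [] λ ℓ → bisect (cappedTest ℓ ℓ (λ j → replicate j true)) L 0 (RunByRun.start ℓ)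

recover-correct : ∀ {n s L} → length s ≤ n → n < 2 ^ L → 2 ^ L ≤ 2 * n →
  ∃[ rs ] length rs ≡ runs s × sum rs ≡ length s × Within n s (recover L) s (8 * n * runCost rs)
recover-correct {n} {s} {L} s≤n n<2^L 2^L≤2n =
  let rs , rs-length , rs-sum , run = RunByRunCorrect.start-correct n s s≤n
      m , run′ , bound = Search.bisect-within ones L z≤n (≤-trans (s≤s (≤-trans ones≤length s≤n)) n<2^L) run
  in rs , rs-length , rs-sum , suc m , ask z≤n (⊆⇒levDist (minimum s)) run′ , (begin
    2 * 2 ^ m                        ≤⟨ *-monoʳ-≤ 2 bound ⟩
    2 * (2 ^ L * (2 * runCost rs))   ≤⟨ *-monoʳ-≤ 2 (*-monoˡ-≤ _ 2^L≤2n) ⟩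
    2 * (2 * n * (2 * runCost rs))   ≡⟨ regroup n (runCost rs) ⟩
    8 * n * runCost rs               ∎)
  where
    open ≤-Reasoning
    ones≤length : count true s ≤ length s
    ones≤length = ≤-trans (m≤m+n _ _) (≤-reflexive (sym (length≡count+count true s)))
    ones : IsThresholdTest n s (cappedTest (length s) (length s) (λ j → replicate j true)) (count true s)
    ones = cappedTest-isThresholdTest (λ j → replicate j true)
      (λ j j≤ → ≤-trans (≤-reflexive (length-replicate j)) (≤-trans j≤ s≤n))
      (λ j j≤ → ⊆-trans (replicate-mono true j≤) (replicate-count-⊆ true s))
      (λ j 1ʲ⊆s → ≤-trans (≤-reflexive (sym (count-replicate true j))) (count-mono true 1ʲ⊆s))
      ones≤length
    regroup : ∀ n w → 2 * (2 * n * (2 * w)) ≡ 8 * n * w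
    regroup = solve-∀

mainTheorem2 : ∃[ c ] ((n : ℕ) → n ≥ 1 → ∃[ A ] ((s : Seq) → length s ≤ n →
    ∃[ m ] (Runs n s A s m × QueryBound c n (runs s) m)))
mainTheorem2 = 3 , λ n n≥1 →
  let L , n<2^L , 2^L≤2n = 2^L-between n n≥1 in
  recover L , λ s s≤n →
    let rs , rs-length , rs-sum , m , run , bound = recover-correct {L = L} s≤n n<2^L 2^L≤2n in
    m , run , subst (λ k → QueryBound 3 n k m) rs-length
                (costBound⇒queryBound n rs m (≤-trans (≤-reflexive rs-sum) s≤n) bound)
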